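{- In each of the two deduction systems DBL and DBL$_\ast$, for all formulas $\phi,\psi,\eta\in\mathcal{L}$: $(\neg\psi|\phi)\equiv\neg(\psi|\phi)$; $(\psi\wedge\eta|\phi)\equiv(\psi|\phi)\wedge(\eta|\phi)$; $(\psi\vee\eta|\phi)\equiv(\psi|\phi)\vee(\eta|\phi)$; and $(\psi\rightarrow\eta|\phi)\equiv(\psi|\phi)\rightarrow(\eta|\phi)$.
   Context: Fix a finite set $\Theta$ of atomic propositions and a distinguished $\theta_1\in\Theta$. The language $\mathcal{L}$ is the smallest set containing $\Theta$ such that $\neg\phi$, $\phi\rightarrow\psi$ and $(\psi|\phi)$ belong to $\mathcal{L}$ whenever $\phi,\psi\in\mathcal{L}$. Abbreviations: $\phi\vee\psi:=\neg\phi\rightarrow\psi$, $\phi\wedge\psi:=\neg(\neg\phi\vee\neg\psi)$, $\phi\leftrightarrow\psi:=(\phi\rightarrow\psi)\wedge(\psi\rightarrow\phi)$, $\psi\times\phi:=(\psi|\phi)\leftrightarrow\psi$, $\top:=\theta_1\rightarrow\theta_1$, $\bot:=\neg\top$. A sequent is a pair of finite (possibly empty) sequences $\Gamma,\Delta$ of formulas of $\mathcal{L}$, written $\Gamma\vdash\Delta$; "$\Gamma,\Delta$" denotes concatenation and $\{\Gamma\}$ the set of entries of $\Gamma$. The systems DBL and DBL$_\ast$ are the smallest sets of sequents $X$ satisfying, for all $\phi,\psi,\eta\in\mathcal{L}$ and finite sequences $\Gamma,\Delta,\Lambda,\Sigma$: (CUT) if $\Gamma\vdash\Delta,\phi$ and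 $\Lambda,\phi\vdash\Sigma$ are in $X$ then $\Gamma,\Lambda\vdash\Delta,\Sigma$ is in $X$; (STRUCT) if $\{\Gamma\}\subset\{\Lambda\}\cup\{\top\}$, $\{\Delta\}\subset\{\Sigma\}\cup\{\bot\}$ and $\Gamma\vdash\Delta$ is in $X$ then $\Lambda\vdash\Sigma$ is in $X$; (modus ponens) $\phi,\phi\rightarrow\psi\vdash\psi$; (c1) $\vdash\phi\rightarrow(\psi\rightarrow\phi)$; (c2) $\vdash(\eta\rightarrow(\phi\rightarrow\psi))\rightarrow((\eta\rightarrow\phi)\rightarrow(\eta\rightarrow\psi))$; (c3) $\vdash(\neg\phi\rightarrow\neg\psi)\rightarrow((\neg\phi\rightarrow\psi)\rightarrow\phi)$; (b1) $\phi\rightarrow\psi\vdash\neg\phi,(\psi|\phi)$; (b2) $\vdash(\psi\rightarrow\eta|\phi)\rightarrow((\psi|\phi)\rightarrow(\eta|\phi))$; (b3) $\vdash(\psi|\phi)\rightarrow(\phi\rightarrow\psi)$; (b4) $\vdash\neg(\neg\psi|\phi)\leftrightarrow(\psi|\phi)$. DBL additionally contains (b5) $\psi\times\phi\vdash\phi\times\psi$. DBL$_\ast$ instead additionally contains (b5.weak.A) $\psi\times\neg\phi\vdash\psi\times\phi$ and $\psi\times\phi\vdash\psi\times\neg\phi$, and (b5.weak.B) $\psi\leftrightarrow\eta\vdash(\phi|\psi)\leftrightarrow(\phi|\eta)$. A sequent is derivable if it belongs to the system; $\phi\equiv\psi$ means that $\vdash\phi\leftrightarrow\psi$ is derivable.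 -}

module Defs where

open import Data.Nat using (ℕ; suc)
open import Data.Fin using (Fin; zero)
open import Data.List using (List; []; _∷_; _++_; [_])
open import Data.List.Membership.Propositional using (_∈_)
open import Data.Sum using (_⊎_)
open import Data.Product using (_×_)
open import Relation.Binary.PropositionalEquality using (_≡_)

module Logic (n : ℕ) where

  Atom : Set
  Atom = Fin (suc n)

  θ₁ : Atom
  θ₁ = zero

  infixr 5 _⇒_
  data Form : Set where
    atom : Atom → Form
    ¬'_  : Form → Form
    _⇒_  : Form → Form → Form
    _∣_  : Form → Form → Form

  _∨'_ : Form → Form → Form
  φ ∨' ψ = (¬' φ) ⇒ ψ

  _∧'_ : Form → Form → Form
  φ ∧' ψ = ¬' ((¬' φ) ∨' (¬' ψ))

  _⇔_ : Form → Form → Form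
  φ ⇔ ψ = (φ ⇒ ψ) ∧' (ψ ⇒ φ)

  _×'_ : Form → Form → Form
  ψ ×' φ = (ψ ∣ φ) ⇔ ψ

  ⊤' : Form
  ⊤' = atom θ₁ ⇒ atom θ₁

  ⊥' : Form
  ⊥' = ¬' ⊤'

  data System : Set where
    DBL DBL* : System

  infix 3 _⊢_[_]
  data _⊢_[_] : List Form → List Form → System → Set where
    cut : ∀ {S Γ Δ Λ Σ φ} → Γ ⊢ Δ ++ [ φ ] [ S ] → Λ ++ [ φ ] ⊢ Σ [ S ] →
          Γ ++ Λ ⊢ Δ ++ Σ [ S ]
    struct : ∀ {S Γ Δ Λ Σ} →
          (∀ {x} → x ∈ Γ → x ∈ Λ ⊎ x ≡ ⊤') →
          (∀ {x} → x ∈ Δ → x ∈ Σ ⊎ x ≡ ⊥') →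
          Γ ⊢ Δ [ S ] → Λ ⊢ Σ [ S ]
    mp : ∀ {S φ ψ} → φ ∷ (φ ⇒ ψ) ∷ [] ⊢ ψ ∷ [] [ S ]
    c1 : ∀ {S φ ψ} → [] ⊢ (φ ⇒ (ψ ⇒ φ)) ∷ [] [ S ]
    c2 : ∀ {S φ ψ η} →
         [] ⊢ ((η ⇒ (φ ⇒ ψ)) ⇒ ((η ⇒ φ) ⇒ (η ⇒ ψ))) ∷ [] [ S ]
    c3 : ∀ {S φ ψ} →
         [] ⊢ (((¬' φ) ⇒ (¬' ψ)) ⇒ (((¬' φ) ⇒ ψ) ⇒ φ)) ∷ [] [ S ]
    b1 : ∀ {S φ ψ} → (φ ⇒ ψ) ∷ [] ⊢ (¬' φ) ∷ (ψ ∣ φ) ∷ [] [ S ]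
    b2 : ∀ {S φ ψ η} →
         [] ⊢ (((ψ ⇒ η) ∣ φ) ⇒ ((ψ ∣ φ) ⇒ (η ∣ φ))) ∷ [] [ S ]
    b3 : ∀ {S φ ψ} → [] ⊢ ((ψ ∣ φ) ⇒ (φ ⇒ ψ)) ∷ [] [ S ]
    b4 : ∀ {S φ ψ} → [] ⊢ ((¬' ((¬' ψ) ∣ φ)) ⇔ (ψ ∣ φ)) ∷ [] [ S ]
    b5 : ∀ {φ ψ} → (ψ ×' φ) ∷ [] ⊢ (φ ×' ψ) ∷ [] [ DBL ]
    b5wA₁ : ∀ {φ ψ} → (ψ ×' (¬' φ)) ∷ [] ⊢ (ψ ×' φ) ∷ [] [ DBL* ]
    b5wA₂ : ∀ {φ ψ} → (ψ ×' φ) ∷ [] ⊢ (ψ ×' (¬' φ)) ∷ [] [ DBL* ]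
    b5wB : ∀ {φ ψ η} →
           (ψ ⇔ η) ∷ [] ⊢ ((φ ∣ ψ) ⇔ (φ ∣ η)) ∷ [] [ DBL* ]

  _≡[_]_ : Form → System → Form → Set
  φ ≡[ S ] ψ = [] ⊢ (φ ⇔ ψ) ∷ [] [ S ]

{-# OPTIONS --safe #-}
-- Both systems contain classical propositional logic, and each derives the
-- necessitation rule: from ⊢ ψ infer ⊢ (ψ|φ).  In DBL, b3 and b4 make every
-- formula φ independent of a theorem ψ (φ × ψ), and b5 turns this around into
-- ψ × φ, i.e. (ψ|φ) ↔ ψ.  In DBL*, b1 yields (ψ|φ) when φ holds; when ¬φ holds
-- it yields (ψ|¬φ), hence ψ × ¬φ, and b5.weak.A gives ψ × φ again.  With
-- necessitation, b2 makes (·|φ) monotone, b4 makes it commute with ¬, and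
-- splitting on (ψ|φ) makes it commute with →; ∨ and ∧ are defined from ¬, →.
module Submission where

open import Defs
open import Data.Nat using (ℕ)
open import Data.Product using (_×_; _,_)
open import Data.List using (List; []; _∷_)
open import Data.List.Relation.Unary.Any using (here; there)
open import Data.Sum using (inj₁)
open import Relation.Binary.PropositionalEquality using (refl)

module _ {n : ℕ} where
  open Logic n

  private
    variable
      S : System
      Γ : List Form
      φ ψ η φ′ ψ′ : Form

  Theorem : System → Form → Set
  Theorem S φ = [] ⊢ φ ∷ [] [ S ]

  detach : Theorem S φ → φ ∷ [] ⊢ ψ ∷ [] [ S ] → Theorem S ψ
  detach {S = S} {φ = φ} {ψ = ψ} ⊢φ φ⊢ψ = cut {S} {[]} {[]} {[]} {ψ ∷ []} {φ} ⊢φ φ⊢ψ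

  ⇒-sequent : Theorem S (φ ⇒ ψ) → φ ∷ [] ⊢ ψ ∷ [] [ S ]
  ⇒-sequent {S = S} {φ = φ} {ψ = ψ} ⊢φ⇒ψ = cut {S} {[]} {[]} {φ ∷ []} {ψ ∷ []} {φ ⇒ ψ} ⊢φ⇒ψ mp

  modus-ponens : Theorem S (φ ⇒ ψ) → Theorem S φ → Theorem S ψ
  modus-ponens ⊢φ⇒ψ ⊢φ = detach ⊢φ (⇒-sequent ⊢φ⇒ψ)

  -- Derivations from hypotheses: the head of Γ is the most recent hypothesis,
  -- and Γ ⊩ φ means ⊢ γₖ → (… → (γ₁ → φ)), so that ⇒-intro is the identity.
  _⇒*_ : List Form → Form → Form
  []      ⇒* φ = φ
  (γ ∷ Γ) ⇒* φ = Γ ⇒* (γ ⇒ φ)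

  infix 3 _⊩_[_]
  record _⊩_[_] (Γ : List Form) (φ : Form) (S : System) : Set where
    constructor from-theorem
    field as-theorem : Theorem S (Γ ⇒* φ)
  open _⊩_[_]

  closed : [] ⊩ φ [ S ] → Theorem S φ
  closed = as-theorem

  mutual
    lift* : ∀ Γ → Theorem S φ → Theorem S (Γ ⇒* φ)
    lift* []      ⊢φ = ⊢φ
    lift* (γ ∷ Γ) ⊢φ = modus-ponens* Γ (lift* Γ c1) (lift* Γ ⊢φ)

    modus-ponens* : ∀ Γ → Theorem S (Γ ⇒* (φ ⇒ ψ)) → Theorem S (Γ ⇒* φ) →
                    Theorem S (Γ ⇒* ψ)
    modus-ponens* []      ⊢φ⇒ψ ⊢φ = modus-ponens ⊢φ⇒ψ ⊢φ
    modus-ponens* (γ ∷ Γ) ⊢φ⇒ψ ⊢φ =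
      modus-ponens* Γ (modus-ponens* Γ (lift* Γ c2) ⊢φ⇒ψ) ⊢φ

  theorem : Theorem S φ → Γ ⊩ φ [ S ]
  theorem {Γ = Γ} ⊢φ = from-theorem (lift* Γ ⊢φ)

  ⇒-elim : Γ ⊩ φ ⇒ ψ [ S ] → Γ ⊩ φ [ S ] → Γ ⊩ ψ [ S ]
  ⇒-elim {Γ = Γ} (from-theorem ⊢φ⇒ψ) (from-theorem ⊢φ) =
    from-theorem (modus-ponens* Γ ⊢φ⇒ψ ⊢φ)

  ⇒-intro : φ ∷ Γ ⊩ ψ [ S ] → Γ ⊩ φ ⇒ ψ [ S ]
  ⇒-intro (from-theorem ⊢φ⇒ψ) = from-theorem ⊢φ⇒ψ

  ⇒-refl : Theorem S (φ ⇒ φ)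
  ⇒-refl {φ = φ} = modus-ponens (modus-ponens (c2 {φ = φ ⇒ φ} {φ} {φ}) c1) (c1 {ψ = φ})

  hyp : φ ∷ Γ ⊩ φ [ S ]
  hyp {Γ = Γ} = from-theorem (lift* Γ ⇒-refl)

  weaken : Γ ⊩ φ [ S ] → ψ ∷ Γ ⊩ φ [ S ]
  weaken ⊩φ = from-theorem (as-theorem (⇒-elim (theorem c1) ⊩φ))

  by-contradiction : ¬' φ ∷ Γ ⊩ ¬' ψ [ S ] → ¬' φ ∷ Γ ⊩ ψ [ S ] → Γ ⊩ φ [ S ]
  by-contradiction ⊩¬ψ ⊩ψ = ⇒-elim (⇒-elim (theorem c3) (⇒-intro ⊩¬ψ)) (⇒-intro ⊩ψ)

  ¬-elim : Γ ⊩ ¬' φ [ S ] → Γ ⊩ φ [ S ] → Γ ⊩ ψ [ S ]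
  ¬-elim ⊩¬φ ⊩φ = by-contradiction (weaken ⊩¬φ) (weaken ⊩φ)

  ¬¬-elim : Γ ⊩ ¬' ¬' φ [ S ] → Γ ⊩ φ [ S ]
  ¬¬-elim ⊩¬¬φ = by-contradiction (weaken ⊩¬¬φ) hyp

  ¬-intro : φ ∷ Γ ⊩ ψ [ S ] → φ ∷ Γ ⊩ ¬' ψ [ S ] → Γ ⊩ ¬' φ [ S ]
  ¬-intro ⊩ψ ⊩¬ψ = by-contradiction (⇒-elim (weaken (⇒-intro ⊩¬ψ)) (¬¬-elim hyp))
                                    (⇒-elim (weaken (⇒-intro ⊩ψ)) (¬¬-elim hyp))

  ¬¬-intro : Γ ⊩ φ [ S ] → Γ ⊩ ¬' ¬' φ [ S ]
  ¬¬-intro ⊩φ = ¬-intro (weaken ⊩φ) hyp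

  by-cases : φ ∷ Γ ⊩ ψ [ S ] → ¬' φ ∷ Γ ⊩ ψ [ S ] → Γ ⊩ ψ [ S ]
  by-cases if-φ if-¬φ =
    by-contradiction hyp
      (⇒-elim (weaken (⇒-intro if-¬φ))
              (¬-intro (⇒-elim (weaken (weaken (⇒-intro if-φ))) hyp) (weaken hyp)))

  ∧-intro : Γ ⊩ φ [ S ] → Γ ⊩ ψ [ S ] → Γ ⊩ φ ∧' ψ [ S ]
  ∧-intro ⊩φ ⊩ψ = ¬-intro (weaken ⊩ψ) (⇒-elim hyp (¬¬-intro (weaken ⊩φ)))

  ∧-elim₁ : Γ ⊩ φ ∧' ψ [ S ] → Γ ⊩ φ [ S ]
  ∧-elim₁ ⊩φ∧ψ = by-contradiction (weaken ⊩φ∧ψ) (⇒-intro (¬-elim hyp (weaken hyp)))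

  ∧-elim₂ : Γ ⊩ φ ∧' ψ [ S ] → Γ ⊩ ψ [ S ]
  ∧-elim₂ ⊩φ∧ψ = by-contradiction (weaken ⊩φ∧ψ) (⇒-intro (weaken hyp))

  ⇔-intro : φ ∷ Γ ⊩ ψ [ S ] → ψ ∷ Γ ⊩ φ [ S ] → Γ ⊩ φ ⇔ ψ [ S ]
  ⇔-intro ⊩ψ ⊩φ = ∧-intro (⇒-intro ⊩ψ) (⇒-intro ⊩φ)

  ⇔-elim₁ : Γ ⊩ φ ⇔ ψ [ S ] → Γ ⊩ φ [ S ] → Γ ⊩ ψ [ S ]
  ⇔-elim₁ ⊩φ⇔ψ = ⇒-elim (∧-elim₁ ⊩φ⇔ψ)

  ⇔-elim₂ : Γ ⊩ φ ⇔ ψ [ S ] → Γ ⊩ ψ [ S ] → Γ ⊩ φ [ S ]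
  ⇔-elim₂ ⊩φ⇔ψ = ⇒-elim (∧-elim₂ ⊩φ⇔ψ)

  ⇔-refl : φ ≡[ S ] φ
  ⇔-refl = closed (⇔-intro hyp hyp)

  ⇔-trans : φ ≡[ S ] ψ → ψ ≡[ S ] η → φ ≡[ S ] η
  ⇔-trans φ⇔ψ ψ⇔η =
    closed (⇔-intro (⇔-elim₁ (theorem ψ⇔η) (⇔-elim₁ (theorem φ⇔ψ) hyp))
                    (⇔-elim₂ (theorem φ⇔ψ) (⇔-elim₂ (theorem ψ⇔η) hyp)))

  ¬-cong : φ ≡[ S ] ψ → (¬' φ) ≡[ S ] (¬' ψ)
  ¬-cong φ⇔ψ =
    closed (⇔-intro (¬-intro (⇔-elim₂ (theorem φ⇔ψ) hyp) (weaken hyp))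
                    (¬-intro (⇔-elim₁ (theorem φ⇔ψ) hyp) (weaken hyp)))

  ⇒-cong : φ ≡[ S ] φ′ → ψ ≡[ S ] ψ′ → (φ ⇒ ψ) ≡[ S ] (φ′ ⇒ ψ′)
  ⇒-cong φ⇔φ′ ψ⇔ψ′ =
    closed (⇔-intro
      (⇒-intro (⇔-elim₁ (theorem ψ⇔ψ′) (⇒-elim (weaken hyp) (⇔-elim₂ (theorem φ⇔φ′) hyp))))
      (⇒-intro (⇔-elim₂ (theorem ψ⇔ψ′) (⇒-elim (weaken hyp) (⇔-elim₁ (theorem φ⇔φ′) hyp)))))

  ∨-cong : φ ≡[ S ] φ′ → ψ ≡[ S ] ψ′ → (φ ∨' ψ) ≡[ S ] (φ′ ∨' ψ′)
  ∨-cong φ⇔φ′ = ⇒-cong (¬-cong φ⇔φ′)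

  explosion : Theorem S (φ ⇒ ¬' φ ⇒ ψ)
  explosion = closed (⇒-intro (⇒-intro (¬-elim hyp (weaken hyp))))

  explosion-¬ : Theorem S (¬' φ ⇒ φ ⇒ ψ)
  explosion-¬ = closed (⇒-intro (⇒-intro (¬-elim (weaken hyp) hyp)))

  cut-right : [] ⊢ φ ∷ ψ ∷ [] [ S ] → ψ ∷ [] ⊢ η ∷ [] [ S ] → [] ⊢ φ ∷ η ∷ [] [ S ]
  cut-right {φ = φ} {ψ = ψ} {S = S} {η = η} ⊢φ,ψ ψ⊢η =
    cut {S} {[]} {φ ∷ []} {[]} {η ∷ []} {ψ} ⊢φ,ψ ψ⊢η

  swap : [] ⊢ φ ∷ ψ ∷ [] [ S ] → [] ⊢ ψ ∷ φ ∷ [] [ S ]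
  swap = struct (λ ()) λ { (here refl) → inj₁ (there (here refl))
                         ; (there (here refl)) → inj₁ (here refl) }

  contract : [] ⊢ φ ∷ φ ∷ [] [ S ] → Theorem S φ
  contract = struct (λ ()) λ { (here refl) → inj₁ (here refl)
                             ; (there (here refl)) → inj₁ (here refl) }

  succedents⇒∨ : [] ⊢ φ ∷ ψ ∷ [] [ S ] → Theorem S (φ ∨' ψ)
  succedents⇒∨ ⊢φ,ψ =
    contract (cut-right (swap (cut-right ⊢φ,ψ (⇒-sequent c1))) (⇒-sequent explosion))

  b1-detached : Theorem S (φ ⇒ ψ) → [] ⊢ ¬' φ ∷ (ψ ∣ φ) ∷ [] [ S ]
  b1-detached {S = S} {φ = φ} {ψ = ψ} ⊢φ⇒ψ =
    cut {S} {[]} {[]} {[]} {¬' φ ∷ (ψ ∣ φ) ∷ []} {φ ⇒ ψ} ⊢φ⇒ψ b1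

  independent-of-theorem : Theorem S ψ → Theorem S (φ ×' ψ)
  independent-of-theorem ⊢ψ =
    closed (⇔-intro (⇒-elim (⇒-elim (theorem b3) hyp) (theorem ⊢ψ))
                    (⇔-elim₁ (theorem b4)
                       (¬-intro (weaken hyp) (⇒-elim (⇒-elim (theorem b3) hyp) (theorem ⊢ψ)))))

  necessitation-DBL : Theorem DBL ψ → Theorem DBL (ψ ∣ φ)
  necessitation-DBL ⊢ψ =
    closed (⇔-elim₂ (theorem (detach (independent-of-theorem ⊢ψ) b5)) (theorem ⊢ψ))

  necessitation-DBL* : Theorem DBL* ψ → Theorem DBL* (ψ ∣ φ)
  necessitation-DBL* {ψ = ψ} {φ = φ} ⊢ψ =
    closed (by-cases {φ = ¬' ¬' φ}
      (⇒-elim (theorem if-φ) hyp)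
      (⇔-elim₂ (⇒-elim (theorem if-¬φ) hyp) (theorem ⊢ψ)))
    where
    ⊢χ⇒ψ : ∀ {χ} → Theorem DBL* (χ ⇒ ψ)
    ⊢χ⇒ψ = modus-ponens c1 ⊢ψ

    if-φ : Theorem DBL* ((¬' φ) ∨' (ψ ∣ φ))
    if-φ = succedents⇒∨ (b1-detached ⊢χ⇒ψ)

    conditional⇒× : Theorem DBL* ((ψ ∣ (¬' φ)) ⇒ ψ ×' (¬' φ))
    conditional⇒× = closed (⇒-intro (⇔-intro (theorem ⊢ψ) (weaken hyp)))

    if-¬φ : Theorem DBL* ((¬' ¬' φ) ∨' (ψ ×' φ))
    if-¬φ = succedents⇒∨
      (cut-right (cut-right (b1-detached ⊢χ⇒ψ) (⇒-sequent conditional⇒×)) b5wA₁)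

  necessitation : ∀ S → Theorem S ψ → Theorem S (ψ ∣ φ)
  necessitation DBL  = necessitation-DBL
  necessitation DBL* = necessitation-DBL*

  conditional-mono : Theorem S (ψ ⇒ η) → Theorem S ((ψ ∣ φ) ⇒ (η ∣ φ))
  conditional-mono {S = S} ⊢ψ⇒η = modus-ponens b2 (necessitation S ⊢ψ⇒η)

  conditional-¬ : ((¬' ψ) ∣ φ) ≡[ S ] (¬' (ψ ∣ φ))
  conditional-¬ {ψ = ψ} {φ = φ} =
    closed (⇔-intro (¬-intro (weaken hyp) (⇔-elim₂ (theorem b4) hyp))
                    (by-contradiction (weaken hyp) (⇔-elim₁ (theorem (b4 {φ = φ} {ψ})) hyp)))

  conditional-⇒ : ((ψ ⇒ η) ∣ φ) ≡[ S ] ((ψ ∣ φ) ⇒ (η ∣ φ))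
  conditional-⇒ {ψ = ψ} {φ = φ} =
    closed (⇔-intro (⇒-elim (theorem b2) hyp)
      (by-cases {φ = ψ ∣ φ}
        (⇒-elim (theorem (conditional-mono c1)) (⇒-elim (weaken hyp) hyp))
        (⇒-elim (theorem (conditional-mono explosion-¬)) (⇔-elim₂ (theorem conditional-¬) hyp))))

  conditional-∨ : ((ψ ∨' η) ∣ φ) ≡[ S ] ((ψ ∣ φ) ∨' (η ∣ φ))
  conditional-∨ = ⇔-trans conditional-⇒ (⇒-cong conditional-¬ ⇔-refl)

  conditional-∧ : ((ψ ∧' η) ∣ φ) ≡[ S ] ((ψ ∣ φ) ∧' (η ∣ φ))
  conditional-∧ =
    ⇔-trans conditional-¬ (¬-cong (⇔-trans conditional-∨ (∨-cong conditional-¬ conditional-¬)))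

mainTheorem3 : (n : ℕ) → let open Logic n in
    (S : System) (φ ψ η : Form) →
      (((¬' ψ) ∣ φ) ≡[ S ] (¬' (ψ ∣ φ)))
    × (((ψ ∧' η) ∣ φ) ≡[ S ] ((ψ ∣ φ) ∧' (η ∣ φ)))
    × (((ψ ∨' η) ∣ φ) ≡[ S ] ((ψ ∣ φ) ∨' (η ∣ φ)))
    × (((ψ ⇒ η) ∣ φ) ≡[ S ] ((ψ ∣ φ) ⇒ (η ∣ φ)))
mainTheorem3 _ _ _ _ _ = conditional-¬ , conditional-∧ , conditional-∨ , conditional-⇒
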